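{- If the $\lambda$-term $M$ is strongly $\beta$-normalising, then there exist a typing context $\Gamma$ and a type $A$ such that $\Gamma\vdash_s M:A$ is derivable in $\Lambda_\cap^s$.
   Context: $\lambda$-terms: $M::=x\mid MM\mid\lambda x.M$ modulo $\alpha$-conversion; $M[x:=N]$ capture-avoiding substitution; $\beta$-reduction is the contextual closure of $(\lambda x.M)N\to M[x:=N]$; strongly normalising means all reduction sequences are finite. Types: $A::=\varphi\mid A\to A\mid A\cap A$. A typing context is a finite set of pairs $x:A$, where a variable may occur with several types; $\Gamma,x:A$ denotes $\Gamma\cup\{x:A\}$; $x\notin\Gamma$ means no $x:B$ lies in $\Gamma$. Rules of $\Lambda_\cap^s$ ($n\ge0$): (Ax) $\Gamma,x:A\vdash_s x:A$; $(\mathsf{Beta})^s$ from $\Gamma\vdash_s M[x:=N]N_1\dots N_n:A$ and $\Gamma\vdash_s N:B$ infer $\Gamma\vdash_s(\lambda x.M)NN_1\dots N_n:A$; $(\mathsf{L}\to)$ from $\Gamma\vdash_s N:A_1$ and $\Gamma,y:A_2\vdash_s yN_1\dots N_n:B$, with $y\notin FV(N_1)\cup\dots\cup FV(N_n)$, $y\notin\Gamma$, infer $\Gamma,x:A_1\to A_2\vdash_s xNN_1\dots N_n:B$; $(\mathsf{R}\to)$ from $\Gamma,x:A\vdash_s M:B$, $x\notin\Gamma$, infer $\Gamma\vdash_s\lambda x.M:A\to B$; $(\mathsf{L}\cap)$ from $\Gamma,x:A_1,x:A_2\vdash_s xN_1\dots N_n:B$ infer $\Gamma,x:A_1\cap A_2\vdash_s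 xN_1\dots N_n:B$; $(\mathsf{R}\cap)$ from $\Gamma\vdash_s M:A$ and $\Gamma\vdash_s M:B$ infer $\Gamma\vdash_s M:A\cap B$. -}

module Defs where

open import Data.Nat using (ℕ; zero; suc)
open import Data.Product using (_×_; _,_; Σ; ∃)
open import Data.List using (List; []; _∷_; map)
open import Data.List.Membership.Propositional using (_∈_)
open import Data.List.Relation.Unary.All using (All)
open import Relation.Nullary using (¬_)
open import Induction.WellFounded using (Acc)

-- λ-terms modulo α-conversion: de Bruijn indices.
-- Free variables are natural numbers (var n with n not bound);
-- `lam M` binds index 0 in M.

data Term : Set where
  var : ℕ → Term
  app : Term → Term → Term
  lam : Term → Term

apps : Term → List Term → Term
apps M []       = M
apps M (N ∷ Ns) = apps (app M N) Ns

ext : (ℕ → ℕ) → ℕ → ℕ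
ext ρ zero    = zero
ext ρ (suc n) = suc (ρ n)

rename : (ℕ → ℕ) → Term → Term
rename ρ (var x)   = var (ρ x)
rename ρ (app M N) = app (rename ρ M) (rename ρ N)
rename ρ (lam M)   = lam (rename (ext ρ) M)

exts : (ℕ → Term) → ℕ → Term
exts σ zero    = var zero
exts σ (suc n) = rename suc (σ n)

sub : (ℕ → Term) → Term → Term
sub σ (var x)   = σ x
sub σ (app M N) = app (sub σ M) (sub σ N)
sub σ (lam M)   = lam (sub (exts σ) M)

sub0 : Term → ℕ → Term
sub0 N zero    = N
sub0 N (suc n) = var n

-- M [ N ] : for `lam M`, this is M[x:=N] (x the bound variable)
_[_] : Term → Term → Term
M [ N ] = sub (sub0 N) M

infix 4 _⟶β_
data _⟶β_ : Term → Term → Set where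
  β    : ∀ {M N} → app (lam M) N ⟶β M [ N ]
  appL : ∀ {M M' N} → M ⟶β M' → app M N ⟶β app M' N
  appR : ∀ {M N N'} → N ⟶β N' → app M N ⟶β app M N'
  ξlam : ∀ {M M'} → M ⟶β M' → lam M ⟶β lam M'

SN : Term → Set
SN = Acc (λ N M → M ⟶β N)

data _∈FV_ : ℕ → Term → Set where
  fv-var  : ∀ {x} → x ∈FV var x
  fv-appL : ∀ {x M N} → x ∈FV M → x ∈FV app M N
  fv-appR : ∀ {x M N} → x ∈FV N → x ∈FV app M N
  fv-lam  : ∀ {x M} → suc x ∈FV M → x ∈FV lam M

_∉FV_ : ℕ → Term → Set
x ∉FV M = ¬ (x ∈FV M)

infixr 7 _⇒_
infixr 8 _∩_
data Type : Set where
  atom : ℕ → Type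
  _⇒_  : Type → Type → Type
  _∩_  : Type → Type → Type

-- typing contexts: finite sets of pairs x : A, represented by lists
-- considered up to having the same elements.

Ctx : Set
Ctx = List (ℕ × Type)

_≈C_ : Ctx → Ctx → Set
Γ ≈C Δ = ∀ p → (p ∈ Γ → p ∈ Δ) × (p ∈ Δ → p ∈ Γ)

_∉dom_ : ℕ → Ctx → Set
x ∉dom Γ = ∀ B → ¬ ((x , B) ∈ Γ)

shiftC : Ctx → Ctx
shiftC = map (λ { (x , A) → (suc x , A) })

infix 3 _⊢s_∶_
data _⊢s_∶_ : Ctx → Term → Type → Set where
  Ax   : ∀ {Γ x A} → (x , A) ∈ Γ → Γ ⊢s var x ∶ A
  Beta : ∀ {Γ M N Ns A B} →
         Γ ⊢s apps (M [ N ]) Ns ∶ A →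
         Γ ⊢s N ∶ B →
         Γ ⊢s apps (app (lam M) N) Ns ∶ A
  L⇒   : ∀ {Δ Γ x y N Ns A₁ A₂ B} →
         Δ ≈C ((x , A₁ ⇒ A₂) ∷ Γ) →
         Γ ⊢s N ∶ A₁ →
         ((y , A₂) ∷ Γ) ⊢s apps (var y) Ns ∶ B →
         All (y ∉FV_) Ns →
         y ∉dom Γ →
         Δ ⊢s apps (var x) (N ∷ Ns) ∶ B
  -- Γ, x:A ⊢ M : B with x ∉ Γ; in de Bruijn form x is index 0 and the
  -- free variables of Γ are shifted past the binder.
  R⇒   : ∀ {Γ M A B} →
         ((zero , A) ∷ shiftC Γ) ⊢s M ∶ B →
         Γ ⊢s lam M ∶ A ⇒ B
  L∩   : ∀ {Δ Γ x Ns A₁ A₂ B} →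
         Δ ≈C ((x , A₁ ∩ A₂) ∷ Γ) →
         ((x , A₁) ∷ (x , A₂) ∷ Γ) ⊢s apps (var x) Ns ∶ B →
         Δ ⊢s apps (var x) Ns ∶ B
  R∩   : ∀ {Γ M A B} →
         Γ ⊢s M ∶ A →
         Γ ⊢s M ∶ B →
         Γ ⊢s M ∶ A ∩ B

-- Strongly normalising terms are generated by three rules: neutral terms x N₁ … Nₙ with
-- SN arguments, abstractions of SN bodies, and head β-expansions (λx.M) N N₁ … Nₙ of SN
-- terms M[x:=N] N₁ … Nₙ with N SN. Each rule has a matching typing rule (L→, R→, Beta),
-- so induction on this generation builds a derivation. Because L→, L∩ and R→ rearrange
-- the context, the induction hypothesis is strengthened: the term is typable in EVERY
-- context that provides each assumption x : A of a fixed context Γ as x : C with A a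
-- conjunct of C; L∩ then digs A out of C. A neutral term x N₁ … Nₙ gets type φ (atom 0), with
-- x : A₁ → … → Aₙ → φ for the types Aᵢ of the arguments.
module Submission where

open import Defs
open import Data.Product using (Σ; _×_; _,_)
open import Data.Nat using (ℕ; zero; suc; _⊔_; _<_; _≤_)
open import Data.Nat.Properties using (≤-refl; ≤-trans; m≤m⊔n; m≤n⊔m; <-irrefl; n≤1+n)
open import Data.List using (List; []; _∷_; _++_)
open import Data.List.Membership.Propositional using (_∈_)
open import Data.List.Relation.Binary.Subset.Propositional using (_⊆_)
open import Data.List.Relation.Binary.Subset.Propositional.Properties
  using (xs⊆xs++ys; xs⊆ys++xs)
open import Data.List.Relation.Unary.Any using (here; there)
open import Data.List.Relation.Unary.All using (All; []; _∷_)
open import Relation.Binary.PropositionalEquality using (refl)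
open import Induction.WellFounded using (acc)

data SNᵢ : Term → Set where
  sn-var : ∀ {x Ns} → All SNᵢ Ns → SNᵢ (apps (var x) Ns)
  sn-lam : ∀ {M} → SNᵢ M → SNᵢ (lam M)
  sn-β   : ∀ {M N Ns} → SNᵢ (apps (M [ N ]) Ns) → SNᵢ N → SNᵢ (apps (app (lam M) N) Ns)

infix 4 _⊑_
data _⊑_ : Term → Term → Set where
  ⊑-refl : ∀ {S} → S ⊑ S
  ⊑-appL : ∀ {S M N} → S ⊑ M → S ⊑ app M N
  ⊑-appR : ∀ {S M N} → S ⊑ N → S ⊑ app M N
  ⊑-lam  : ∀ {S M} → S ⊑ M → S ⊑ lam M

⊑-trans : ∀ {S T U} → S ⊑ T → T ⊑ U → S ⊑ U
⊑-trans p ⊑-refl     = p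
⊑-trans p (⊑-appL q) = ⊑-appL (⊑-trans p q)
⊑-trans p (⊑-appR q) = ⊑-appR (⊑-trans p q)
⊑-trans p (⊑-lam q)  = ⊑-lam (⊑-trans p q)

head-⊑-apps : ∀ {H} Ns → H ⊑ apps H Ns
head-⊑-apps []       = ⊑-refl
head-⊑-apps (N ∷ Ns) = ⊑-trans (⊑-appL ⊑-refl) (head-⊑-apps Ns)

arg-⊑-apps : ∀ {H N} Ns → N ⊑ apps (app H N) Ns
arg-⊑-apps Ns = ⊑-trans (⊑-appR ⊑-refl) (head-⊑-apps Ns)

⊑-⟶β : ∀ {S S' T} → S ⊑ T → S ⟶β S' → Σ Term (λ T' → (T ⟶β T') × (S' ⊑ T'))
⊑-⟶β ⊑-refl r = _ , r , ⊑-refl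
⊑-⟶β (⊑-appL p) r with ⊑-⟶β p r
... | _ , r' , q = _ , appL r' , ⊑-appL q
⊑-⟶β (⊑-appR p) r with ⊑-⟶β p r
... | _ , r' , q = _ , appR r' , ⊑-appR q
⊑-⟶β (⊑-lam p) r with ⊑-⟶β p r
... | _ , r' , q = _ , ξlam r' , ⊑-lam q

apps-⟶β : ∀ {M M'} Ns → M ⟶β M' → apps M Ns ⟶β apps M' Ns
apps-⟶β []       r = r
apps-⟶β (N ∷ Ns) r = apps-⟶β Ns (appL r)

-- Recursion is on the accessibility proof of an enclosing term T and, for fixed T, on the
-- structure of the subterm S; this avoids proving SN closed under subterms first.
mutual
  SN⇒SNᵢ-⊑ : ∀ T → SN T → ∀ {S} → S ⊑ T → SNᵢ S
  SN⇒SNᵢ-⊑ T a {var x}   p = sn-var []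
  SN⇒SNᵢ-⊑ T a {app M N} p =
    SN⇒SNᵢ-spine T a M (N ∷ []) p (SN⇒SNᵢ-⊑ T a (⊑-trans (⊑-appR ⊑-refl) p) ∷ [])
  SN⇒SNᵢ-⊑ T a {lam M}   p = sn-lam (SN⇒SNᵢ-⊑ T a (⊑-trans (⊑-lam ⊑-refl) p))

  SN⇒SNᵢ-spine : ∀ T → SN T → ∀ H Ns → apps H Ns ⊑ T → All SNᵢ Ns → SNᵢ (apps H Ns)
  SN⇒SNᵢ-spine T a (var x) Ns p sns = sn-var sns
  SN⇒SNᵢ-spine T a (app M N) Ns p sns =
    SN⇒SNᵢ-spine T a M (N ∷ Ns) p (SN⇒SNᵢ-⊑ T a (⊑-trans (arg-⊑-apps Ns) p) ∷ sns)
  SN⇒SNᵢ-spine T a (lam M) [] p sns = sn-lam (SN⇒SNᵢ-⊑ T a (⊑-trans (⊑-lam ⊑-refl) p))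
  SN⇒SNᵢ-spine T (acc rs) (lam M) (N ∷ Ns) p (sN ∷ sns) with ⊑-⟶β p (apps-⟶β Ns (β {M} {N}))
  ... | T' , r , q = sn-β {M} {N} {Ns} (SN⇒SNᵢ-⊑ T' (rs r) q) sN

SN⇒SNᵢ : ∀ {M} → SN M → SNᵢ M
SN⇒SNᵢ {M} a = SN⇒SNᵢ-⊑ M a ⊑-refl

infix 4 _∈∩_ _⊆∩_
data _∈∩_ : Type → Type → Set where
  ∈∩-refl  : ∀ {A} → A ∈∩ A
  ∈∩-left  : ∀ {A C₁ C₂} → A ∈∩ C₁ → A ∈∩ C₁ ∩ C₂
  ∈∩-right : ∀ {A C₁ C₂} → A ∈∩ C₂ → A ∈∩ C₁ ∩ C₂

_⊆∩_ : Ctx → Ctx → Set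
Γ ⊆∩ Δ = ∀ {x A} → (x , A) ∈ Γ → Σ Type (λ C → ((x , C) ∈ Δ) × (A ∈∩ C))

⊆∩-refl : ∀ {Γ} → Γ ⊆∩ Γ
⊆∩-refl {A = A} m = A , m , ∈∩-refl

⊆∩-⊆-trans : ∀ {Γ Δ Δ'} → Γ ⊆∩ Δ → Δ ⊆ Δ' → Γ ⊆∩ Δ'
⊆∩-⊆-trans c s m with c m
... | C , m' , o = C , s m' , o

⊆-⊆∩-trans : ∀ {Γ' Γ Δ} → Γ' ⊆ Γ → Γ ⊆∩ Δ → Γ' ⊆∩ Δ
⊆-⊆∩-trans s c m = c (s m)

Typable : Term → Set
Typable M = Σ Ctx (λ Γ → Σ Type (λ A → ∀ Δ → Γ ⊆∩ Δ → Δ ⊢s M ∶ A))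

fvBound : Term → ℕ
fvBound (var x)   = suc x
fvBound (app M N) = fvBound M ⊔ fvBound N
fvBound (lam M)   = fvBound M

∈FV⇒<fvBound : ∀ {x M} → x ∈FV M → x < fvBound M
∈FV⇒<fvBound fv-var = ≤-refl
∈FV⇒<fvBound {M = app M N} (fv-appL p) = ≤-trans (∈FV⇒<fvBound p) (m≤m⊔n (fvBound M) (fvBound N))
∈FV⇒<fvBound {M = app M N} (fv-appR p) = ≤-trans (∈FV⇒<fvBound p) (m≤n⊔m (fvBound M) (fvBound N))
∈FV⇒<fvBound (fv-lam p) = ≤-trans (n≤1+n _) (∈FV⇒<fvBound p)

fvBounds : List Term → ℕ
fvBounds []       = 0
fvBounds (N ∷ Ns) = fvBound N ⊔ fvBounds Ns

domBound : Ctx → ℕ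
domBound []            = 0
domBound ((x , _) ∷ Γ) = suc x ⊔ domBound Γ

∈⇒<domBound : ∀ {x B} Γ → (x , B) ∈ Γ → x < domBound Γ
∈⇒<domBound ((y , _) ∷ Γ) (here refl) = m≤m⊔n (suc y) (domBound Γ)
∈⇒<domBound ((y , _) ∷ Γ) (there m)   = ≤-trans (∈⇒<domBound Γ m) (m≤n⊔m (suc y) (domBound Γ))

fvBounds≤⇒∉FV : ∀ Ns {y} → fvBounds Ns ≤ y → All (y ∉FV_) Ns
fvBounds≤⇒∉FV []       le = []
fvBounds≤⇒∉FV (N ∷ Ns) le =
  (λ p → <-irrefl refl (≤-trans (∈FV⇒<fvBound p) (≤-trans (m≤m⊔n (fvBound N) (fvBounds Ns)) le)))
  ∷ fvBounds≤⇒∉FV Ns (≤-trans (m≤n⊔m (fvBound N) (fvBounds Ns)) le)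

domBound≤⇒∉dom : ∀ Γ {y} → domBound Γ ≤ y → y ∉dom Γ
domBound≤⇒∉dom Γ le B m = <-irrefl refl (≤-trans (∈⇒<domBound Γ m) le)

∈⇒≈C-∷ : ∀ {p Δ} → p ∈ Δ → Δ ≈C (p ∷ Δ)
∈⇒≈C-∷ m q = there , λ { (here refl) → m ; (there k) → k }

L∩-select : ∀ {Δ x C A Ns B} → (x , C) ∈ Δ → A ∈∩ C →
            (∀ Δ' → Δ ⊆ Δ' → (x , A) ∈ Δ' → Δ' ⊢s apps (var x) Ns ∶ B) →
            Δ ⊢s apps (var x) Ns ∶ B
L∩-select {Δ} m ∈∩-refl k = k Δ (λ z → z) m
L∩-select {Ns = Ns} m (∈∩-left o) k =
  L∩ {Ns = Ns} (∈⇒≈C-∷ m)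
     (L∩-select {Ns = Ns} (here refl) o (λ Δ' s → k Δ' (λ z → s (there (there z)))))
L∩-select {Ns = Ns} m (∈∩-right o) k =
  L∩ {Ns = Ns} (∈⇒≈C-∷ m)
     (L∩-select {Ns = Ns} (there (here refl)) o (λ Δ' s → k Δ' (λ z → s (there (there z)))))

argsCtx : ∀ {Ns} → All Typable Ns → Ctx
argsCtx []                 = []
argsCtx ((Γ , _ , _) ∷ ts) = Γ ++ argsCtx ts

spineType : ∀ {Ns} → All Typable Ns → Type
spineType []                 = atom 0
spineType ((_ , A , _) ∷ ts) = A ⇒ spineType ts

-- The fresh variable y of L→ is chosen above every variable of Δ and of the remaining arguments.
neutral-⊢s : ∀ {Ns} (ts : All Typable Ns) {Δ x} → (x , spineType ts) ∈ Δ → argsCtx ts ⊆∩ Δ →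
             Δ ⊢s apps (var x) Ns ∶ atom 0
neutral-⊢s [] m c = Ax m
neutral-⊢s {N ∷ Ns} ((Γ , _ , ⊢N) ∷ ts) {Δ} m c =
  L⇒ (∈⇒≈C-∷ m) (⊢N Δ (⊆-⊆∩-trans (xs⊆xs++ys Γ _) c))
     (neutral-⊢s ts (here refl) (⊆∩-⊆-trans (⊆-⊆∩-trans (xs⊆ys++xs _ Γ) c) there))
     (fvBounds≤⇒∉FV Ns (m≤n⊔m (domBound Δ) (fvBounds Ns)))
     (domBound≤⇒∉dom Δ (m≤m⊔n (domBound Δ) (fvBounds Ns)))

unshiftC : Ctx → Ctx
unshiftC []                = []
unshiftC ((zero , _) ∷ Γ)  = unshiftC Γ
unshiftC ((suc x , B) ∷ Γ) = (x , B) ∷ unshiftC Γ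

-- the intersection of all types assumed for variable 0, padded with φ so that it is never empty
typeOf0 : Ctx → Type
typeOf0 []                = atom 0
typeOf0 ((zero , B) ∷ Γ)  = B ∩ typeOf0 Γ
typeOf0 ((suc _ , _) ∷ Γ) = typeOf0 Γ

∈⇒∈∩-typeOf0 : ∀ Γ {B} → (zero , B) ∈ Γ → B ∈∩ typeOf0 Γ
∈⇒∈∩-typeOf0 ((zero , _) ∷ Γ)  (here refl) = ∈∩-left ∈∩-refl
∈⇒∈∩-typeOf0 ((zero , _) ∷ Γ)  (there m)   = ∈∩-right (∈⇒∈∩-typeOf0 Γ m)
∈⇒∈∩-typeOf0 ((suc _ , _) ∷ Γ) (there m)   = ∈⇒∈∩-typeOf0 Γ m

∈-unshiftC : ∀ Γ {x B} → (suc x , B) ∈ Γ → (x , B) ∈ unshiftC Γ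
∈-unshiftC ((zero , _) ∷ Γ)  (there m)   = ∈-unshiftC Γ m
∈-unshiftC ((suc _ , _) ∷ Γ) (here refl) = here refl
∈-unshiftC ((suc _ , _) ∷ Γ) (there m)   = there (∈-unshiftC Γ m)

∈-shiftC : ∀ Δ {x C} → (x , C) ∈ Δ → (suc x , C) ∈ shiftC Δ
∈-shiftC (_ ∷ Δ) (here refl) = here refl
∈-shiftC (_ ∷ Δ) (there m)   = there (∈-shiftC Δ m)

⊆∩-under-binder : ∀ Γ {Δ} → unshiftC Γ ⊆∩ Δ → Γ ⊆∩ (zero , typeOf0 Γ) ∷ shiftC Δ
⊆∩-under-binder Γ c {zero}  m = typeOf0 Γ , here refl , ∈⇒∈∩-typeOf0 Γ m
⊆∩-under-binder Γ {Δ} c {suc x} m with c (∈-unshiftC Γ m)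
... | C , m' , o = C , there (∈-shiftC Δ m') , o

mutual
  SNᵢ⇒Typable : ∀ {M} → SNᵢ M → Typable M
  SNᵢ⇒Typable (sn-var {x} {Ns} sns) with All-SNᵢ⇒Typable sns
  ... | ts = (x , spineType ts) ∷ argsCtx ts , atom 0 , λ Δ c →
    let (C , m , o) = c (here refl) in
    L∩-select {Ns = Ns} m o (λ Δ' s m' → neutral-⊢s ts m' (⊆∩-⊆-trans (⊆-⊆∩-trans there c) s))
  SNᵢ⇒Typable (sn-lam sM) with SNᵢ⇒Typable sM
  ... | Γ , B , ⊢M = unshiftC Γ , typeOf0 Γ ⇒ B , λ Δ c → R⇒ (⊢M _ (⊆∩-under-binder Γ c))
  SNᵢ⇒Typable (sn-β {M} {Ns = Ns} sR sN) with SNᵢ⇒Typable sR | SNᵢ⇒Typable sN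
  ... | Γ₁ , A , ⊢R | Γ₂ , _ , ⊢N = Γ₁ ++ Γ₂ , A , λ Δ c →
    Beta {M = M} {Ns = Ns} (⊢R Δ (⊆-⊆∩-trans (xs⊆xs++ys Γ₁ Γ₂) c))
                           (⊢N Δ (⊆-⊆∩-trans (xs⊆ys++xs Γ₂ Γ₁) c))

  All-SNᵢ⇒Typable : ∀ {Ns} → All SNᵢ Ns → All Typable Ns
  All-SNᵢ⇒Typable []        = []
  All-SNᵢ⇒Typable (s ∷ sns) = SNᵢ⇒Typable s ∷ All-SNᵢ⇒Typable sns

theorem4 : (M : Term) → SN M → Σ Ctx (λ Γ → Σ Type (λ A → Γ ⊢s M ∶ A))
theorem4 M sn with SNᵢ⇒Typable (SN⇒SNᵢ sn)
... | Γ , A , ⊢M = Γ , A , ⊢M Γ ⊆∩-refl
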